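{- Let $c$ be a positive integer, $T$ a simple tree and $v$ a vertex of $T$. Then there is a constant $c'$ depending only on $c,v,T$ such that for all positive integers $N,k$ and every spanning grid subgraph $G$ of $G_{N\times N}$ with no coclique of size $k$, at least $N^2-c'Nk$ vertices of $G$ are $c$-diverse for $v\in T$.
   Context: A grid subgraph on $c$ columns and $r$ rows is a graph whose vertex set is a subset of $[c]\times[r]$ (vertex $(x,y)$ in column $x$, row $y$) and whose edges each join two vertices in the same row or the same column. $G_{N\times N}=K_N\square K_N$; a spanning grid subgraph is a spanning subgraph of it. An embedding of $T$ (on $c_T$ columns, $r_T$ rows) into $G$ is a pair of injections $\varphi_c:[c_T]\to[N]$, $\varphi_r:[r_T]\to[N]$ sending each edge $\{(x,y),(x',y')\}$ of $T$ to an edge $\{(\varphi_c(x),\varphi_r(y)),(\varphi_c(x'),\varphi_r(y'))\}$ of $G$. A coclique of size $k$ is a set of $k$ pairwise non-adjacent vertices all in one row or all in one column. A grid subgraph is simple if for each row and column, the subgraph induced on its vertices in that row (resp. column) is connected; a simple tree is a simple grid subgraph which is a tree. For a simple tree $T$, a vertex $v=(s,t)$ of $T$, and an integer $n\ge1$: a vertex $(a,b)$ of $G$ is $n$-diverse for $v\in T$ if there exist embeddings $(\varphi^{(i)}_c,\varphi^{(i)}_r)$, $1\le i\le n$, of $T$ into $G$ such that $\varphi^{(i)}_c(s)=a$ and $\varphi^{(i)}_r(t)=b$ for all $i$; for all $i_1\ne i_2$ and all $j_1,j_2$, $\varphi^{(i_1)}_c(j_1)=\varphi^{(i_2)}_c(j_2)$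 implies $j_1=j_2=s$; and for all $i_1\ne i_2$ and all $j_1,j_2$, $\varphi^{(i_1)}_r(j_1)=\varphi^{(i_2)}_r(j_2)$ implies $j_1=j_2=t$. -}

module Defs where

open import Data.Nat using (ℕ; zero; suc; _+_; _*_; _≤_)
open import Data.Fin using (Fin; zero; suc; inject₁; fromℕ)
open import Data.Bool using (Bool; true; false)
open import Data.Product using (_×_; _,_; Σ; ∃; ∃-syntax)
open import Data.Sum using (_⊎_)
open import Relation.Binary.PropositionalEquality using (_≡_; _≢_)
open import Relation.Nullary using (¬_)
open import Function.Definitions using (Injective)

-- Grid subgraphs on c columns and r rows.
-- Vertex (x , y) : column x, row y.  Columns/rows are indexed by Fin.

Cell : ℕ → ℕ → Set
Cell c r = Fin c × Fin r

record GridSubgraph (c r : ℕ) : Set where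
  field
    V      : Cell c r → Bool
    E      : Cell c r → Cell c r → Bool
    E-sym    : ∀ p q → E p q ≡ E q p
    E-irrefl : ∀ p → E p p ≡ false
    E-vert   : ∀ p q → E p q ≡ true → V p ≡ true × V q ≡ true
    E-line   : ∀ x y x' y' → E (x , y) (x' , y') ≡ true → x ≡ x' ⊎ y ≡ y'

open GridSubgraph public

data WalkIn {A : Set} (Adj : A → A → Bool) (P : A → Set) : A → A → Set where
  here  : ∀ {a} → P a → WalkIn Adj P a a
  step  : ∀ {a b c} → P a → Adj a b ≡ true → WalkIn Adj P b c → WalkIn Adj P a c

ConnectedIn : {A : Set} → (A → A → Bool) → (A → Set) → Set
ConnectedIn {A} Adj P = ∀ (a b : A) → P a → P b → WalkIn Adj P a b

module _ {c r : ℕ} (T : GridSubgraph c r) where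

  IsVertex : Cell c r → Set
  IsVertex p = V T p ≡ true

  IsSimple : Set
  IsSimple =
      (∀ (y : Fin r) → ConnectedIn (E T) (λ p → IsVertex p × Data.Product.proj₂ p ≡ y))
    × (∀ (x : Fin c) → ConnectedIn (E T) (λ p → IsVertex p × Data.Product.proj₁ p ≡ x))

  Connected : Set
  Connected = ConnectedIn (E T) IsVertex

  Cycle : Set
  Cycle = Σ ℕ λ m → Σ (Fin (suc (suc (suc m))) → Cell c r) λ f →
            Injective _≡_ _≡_ f
          × (∀ (i : Fin (suc (suc m))) → E T (f (inject₁ i)) (f (suc i)) ≡ true)
          × E T (f (fromℕ (suc (suc m)))) (f zero) ≡ true

  IsTree : Set
  IsTree = Connected × ¬ Cycle

  IsSimpleTree : Set
  IsSimpleTree = IsSimple × IsTree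

IsSpanning : {N : ℕ} → GridSubgraph N N → Set
IsSpanning G = ∀ p → V G p ≡ true

record Embedding {cT rT N : ℕ} (T : GridSubgraph cT rT) (G : GridSubgraph N N) : Set where
  field
    φc : Fin cT → Fin N
    φr : Fin rT → Fin N
    φc-inj : Injective _≡_ _≡_ φc
    φr-inj : Injective _≡_ _≡_ φr
    φ-edge : ∀ x y x' y' → E T (x , y) (x' , y') ≡ true →
             E G (φc x , φr y) (φc x' , φr y') ≡ true

open Embedding public

HasCoclique : {N : ℕ} → GridSubgraph N N → ℕ → Set
HasCoclique {N} G k =
    (Σ (Fin N) λ y → Σ (Fin k → Fin N) λ f → Injective _≡_ _≡_ f
        × (∀ i j → i ≢ j → E G (f i , y) (f j , y) ≡ false))
  ⊎ (Σ (Fin N) λ x → Σ (Fin k → Fin N) λ f → Injective _≡_ _≡_ f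
        × (∀ i j → i ≢ j → E G (x , f i) (x , f j) ≡ false))

Diverse : {cT rT N : ℕ} (T : GridSubgraph cT rT) (v : Cell cT rT)
          (G : GridSubgraph N N) (n : ℕ) (w : Cell N N) → Set
Diverse {cT} {rT} T (s , t) G n (a , b) =
  Σ (Fin n → Embedding T G) λ φ →
      (∀ i → φc (φ i) s ≡ a × φr (φ i) t ≡ b)
    × (∀ i₁ i₂ → i₁ ≢ i₂ → ∀ (j₁ j₂ : Fin cT) →
         φc (φ i₁) j₁ ≡ φc (φ i₂) j₂ → j₁ ≡ s × j₂ ≡ s)
    × (∀ i₁ i₂ → i₁ ≢ i₂ → ∀ (j₁ j₂ : Fin rT) →
         φr (φ i₁) j₁ ≡ φr (φ i₂) j₂ → j₁ ≡ t × j₂ ≡ t)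

AtLeast : {N : ℕ} → ℕ → (Cell N N → Set) → Set
AtLeast {N} m P = Σ (Fin m → Cell N N) λ g → Injective _≡_ _≡_ g × (∀ i → P (g i))

{-# OPTIONS --safe #-}
module Submission where

-- Prune the grid in rounds: a cell survives round r + 1 if, among the survivors of round r, it has
-- more than Δ = c (cT + rT) neighbours in its row and more than Δ in its column. In a fixed line the
-- cells removed in one round induce a graph of maximum degree at most Δ, so a greedy independent set,
-- which is a coclique of G, shows that at most k (Δ + 1) of them are removed; hence each round
-- removes at most 2 N k (Δ + 1) cells.
-- From a cell (a , b) surviving cT + rT + 1 rounds, T is embedded with v ↦ (a , b) by giving images
-- to the columns and rows of T one at a time, moving outward from v: the next vertex q shares a line
-- with a placed neighbour p, and because T is a simple tree, q is the only vertex that becomes placed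
-- and p is its only placed neighbour. The image of q is picked among the more than Δ surviving
-- neighbours of the image of p in that line, avoiding the lines used by earlier copies; doing this
-- c times gives the c copies that witness diversity.

open import Defs
open import Algebra.Properties.CommutativeMonoid.Sum as Sum using ()
import Algebra.Properties.CommutativeSemigroup
open import Data.Bool using (Bool; true; false; not; _∧_; _∨_)
open import Data.Bool.Properties using () renaming (_≟_ to _≟ᵇ_)
open import Data.Empty using (⊥-elim)
open import Data.Fin using (Fin; zero; suc; inject₁; fromℕ; splitAt; join)
open import Data.Fin.Properties using (_≟_; suc-injective; any?; join-splitAt)
open import Data.List using (List; []; _∷_; length; _++_; mapMaybe; allFin; tabulate)
open import Data.List.Properties using (length-mapMaybe; length-tabulate; length-++)
open import Data.List.Membership.Propositional using (_∈_; _∉_)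
open import Data.List.Membership.Propositional.Properties using (∈-allFin; ∈-tabulate⁺; ∈-++⁺ˡ; ∈-++⁺ʳ)
open import Data.List.Membership.DecPropositional using () renaming (_∈?_ to ∈?)
open import Data.List.Relation.Unary.Any using (here; there)
open import Data.Maybe using (Maybe; just; nothing; is-nothing)
open import Data.Maybe.Properties using (just-injective) renaming (≡-dec to ≡-dec-Maybe)
open import Data.Nat using (ℕ; zero; suc; _+_; _*_; _≤_; _<_; _≤?_; z≤n; s≤s)
open import Data.Nat.Properties hiding (_≟_; suc-injective)
open import Data.Nat.Tactic.RingSolver using (solve-∀)
open import Data.Product using (Σ; _×_; ∃; ∃₂; _,_; proj₁; proj₂; map₂; swap)
open import Data.Product.Properties using (≡-dec)
open import Data.Sum using (_⊎_; inj₁; inj₂)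
open import Data.Unit using (⊤; tt)
open import Function using (_∘_)
open import Function.Definitions using (Injective)
open import Relation.Binary.Construct.Closure.ReflexiveTransitive using (Star; ε; _◅_; _◅◅_)
  renaming (map to Star-map; reverse to Star-reverse)
open import Relation.Binary.PropositionalEquality
open import Relation.Nullary using (¬_; Dec; does; yes; no; ¬?)
open import Relation.Nullary.Decidable using (dec-true; _×-dec_; decidable-stable)
open import Relation.Unary using (Decidable)

open Sum +-0-commutativeMonoid using (sum; ∑-distrib-+; ∑-comm; sum-cong-≗)
open Algebra.Properties.CommutativeSemigroup +-commutativeSemigroup using (interchange)

private variable
  A : Set
  n : ℕ

∧-≡-true : ∀ a {b} → a ∧ b ≡ true → a ≡ true × b ≡ true
∧-≡-true true {true} _ = refl , refl

not-≡-true : ∀ {a} → not a ≡ true → a ≡ false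
not-≡-true {false} _ = refl

does-true⇒ : (A? : Dec A) → does A? ≡ true → A
does-true⇒ (yes a) _ = a

does-false⇒ : (A? : Dec A) → does A? ≡ false → ¬ A
does-false⇒ (no ¬a) _ = ¬a

-- Counting over Fin

sum-mono-≤ : {f g : Fin n → ℕ} → (∀ i → f i ≤ g i) → sum f ≤ sum g
sum-mono-≤ {zero} f≤g = z≤n
sum-mono-≤ {suc n} f≤g = +-mono-≤ (f≤g zero) (sum-mono-≤ (f≤g ∘ suc))

sum≤n*a : ∀ {a} {f : Fin n → ℕ} → (∀ i → f i ≤ a) → sum f ≤ n * a
sum≤n*a {zero} f≤a = z≤n
sum≤n*a {suc n} f≤a = +-mono-≤ (f≤a zero) (sum≤n*a (f≤a ∘ suc))

indicator : Bool → ℕ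
indicator true = 1
indicator false = 0

count : (Fin n → Bool) → ℕ
count {zero} p = 0
count {suc n} p = indicator (p zero) + count (p ∘ suc)

count≡sum : (p : Fin n → Bool) → count p ≡ sum (indicator ∘ p)
count≡sum {zero} p = refl
count≡sum {suc n} p = cong (indicator (p zero) +_) (count≡sum (p ∘ suc))

_⊆ᵇ_ : (Fin n → Bool) → (Fin n → Bool) → Set
p ⊆ᵇ q = ∀ i → p i ≡ true → q i ≡ true

indicator-mono : ∀ {a b} → (a ≡ true → b ≡ true) → indicator a ≤ indicator b
indicator-mono {false} _ = z≤n
indicator-mono {true} a⇒b rewrite a⇒b refl = ≤-refl

count-mono : {p q : Fin n → Bool} → p ⊆ᵇ q → count p ≤ count q
count-mono {zero} p⊆q = z≤n
count-mono {suc n} p⊆q = +-mono-≤ (indicator-mono (p⊆q zero)) (count-mono (p⊆q ∘ suc))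

count-< : {p q : Fin n → Bool} → p ⊆ᵇ q → ∀ {i} → p i ≡ false → q i ≡ true → count p < count q
count-< p⊆q {zero} pi qi rewrite pi | qi = s≤s (count-mono (p⊆q ∘ suc))
count-< p⊆q {suc i} pi qi =
  +-mono-≤-< (indicator-mono (p⊆q zero)) (count-< (p⊆q ∘ suc) pi qi)

count-∨ : (p q : Fin n → Bool) → count (λ i → p i ∨ q i) ≤ count p + count q
count-∨ {zero} p q = z≤n
count-∨ {suc n} p q = begin
  indicator (p zero ∨ q zero) + count (λ i → p (suc i) ∨ q (suc i))
    ≤⟨ +-mono-≤ (indicator-∨ (p zero) (q zero)) (count-∨ (p ∘ suc) (q ∘ suc)) ⟩
  (indicator (p zero) + indicator (q zero)) + (count (p ∘ suc) + count (q ∘ suc))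
    ≡⟨ interchange (indicator (p zero)) (indicator (q zero)) _ _ ⟩
  count p + count q ∎
  where
  open ≤-Reasoning
  indicator-∨ : ∀ a b → indicator (a ∨ b) ≤ indicator a + indicator b
  indicator-∨ true _ = s≤s z≤n
  indicator-∨ false _ = ≤-refl

count-cover : {p : Fin n → Bool} (q r : Fin n → Bool) → p ⊆ᵇ (λ i → q i ∨ r i) →
              count p ≤ count q + count r
count-cover q r p⊆q∨r = ≤-trans (count-mono p⊆q∨r) (count-∨ q r)

count-∧-monoʳ : (p : Fin n → Bool) {q q′ : Fin n → Bool} → q ⊆ᵇ q′ →
                count (λ i → p i ∧ q i) ≤ count (λ i → p i ∧ q′ i)
count-∧-monoʳ p q⊆q′ = count-mono λ i e → let pi , qi = ∧-≡-true (p i) e in cong₂ _∧_ pi (q⊆q′ i qi)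

count≤n : (p : Fin n → Bool) → count p ≤ n
count≤n {zero} p = z≤n
count≤n {suc n} p = +-mono-≤ (indicator≤1 (p zero)) (count≤n (p ∘ suc))
  where
  indicator≤1 : ∀ a → indicator a ≤ 1
  indicator≤1 true = ≤-refl
  indicator≤1 false = z≤n

count+count-not : (p : Fin n → Bool) → count p + count (not ∘ p) ≡ n
count+count-not {zero} p = refl
count+count-not {suc n} p with p zero
... | true = cong suc (count+count-not (p ∘ suc))
... | false = trans (+-suc _ _) (cong suc (count+count-not (p ∘ suc)))

count>0⇒∃ : (p : Fin n → Bool) → 0 < count p → ∃ λ i → p i ≡ true
count>0⇒∃ {suc n} p pos with p zero in p0
... | true = zero , p0
... | false with (i , pi) ← count>0⇒∃ (p ∘ suc) pos = suc i , pi

∃⇒count>0 : (p : Fin n → Bool) {i : Fin n} → p i ≡ true → 0 < count p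
∃⇒count>0 p {zero} pi rewrite pi = s≤s z≤n
∃⇒count>0 p {suc i} pi = ≤-trans (∃⇒count>0 (p ∘ suc) pi) (m≤n+m _ (indicator (p zero)))

count-false : count {n} (λ _ → false) ≡ 0
count-false {zero} = refl
count-false {suc n} = count-false {n}

count-true : count {n} (λ _ → true) ≡ n
count-true {zero} = refl
count-true {suc n} = cong suc (count-true {n})

count-≡ : (i : Fin n) → count (λ j → does (i ≟ j)) ≤ 1
count-≡ {suc n} zero = s≤s (≤-reflexive (count-false {n}))
count-≡ {suc n} (suc i) = count-≡ i

_-ᵇ_ : (Fin n → Bool) → Fin n → Fin n → Bool
(P -ᵇ x) X = not (does (x ≟ X)) ∧ P X

count≤1+count-ᵇ : ∀ (P : Fin n → Bool) x → count P ≤ suc (count (P -ᵇ x))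
count≤1+count-ᵇ P x = ≤-trans (count-cover _ (P -ᵇ x) P⊆x∨P-x) (+-monoˡ-≤ _ (count-≡ x))
  where
  P⊆x∨P-x : P ⊆ᵇ (λ X → does (x ≟ X) ∨ (P -ᵇ x) X)
  P⊆x∨P-x X PX with x ≟ X
  ... | yes _ = refl
  ... | no _ = PX

fresh : (P : Fin n → Bool) (xs : List (Fin n)) → length xs < count P →
        ∃ λ X → P X ≡ true × X ∉ xs
fresh P [] pos = let X , PX = count>0⇒∃ P pos in X , PX , λ ()
fresh P (x ∷ xs) xs<P with fresh (P -ᵇ x) xs (≤-pred (≤-trans xs<P (count≤1+count-ᵇ P x)))
... | X , P-xX , X∉xs = X , proj₂ (∧-≡-true _ P-xX) , X∉x∷xs
  where
  X∉x∷xs : X ∉ x ∷ xs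
  X∉x∷xs (here refl) with () ← subst (λ b → not b ∧ P X ≡ true) (dec-true (X ≟ X) refl) P-xX
  X∉x∷xs (there X∈xs) = X∉xs X∈xs

Enumeration : (A → Bool) → ℕ → Set
Enumeration {A} p m = Σ (Fin m → A) λ g → Injective _≡_ _≡_ g × (∀ i → p (g i) ≡ true)

enumerate : (p : Fin n → Bool) → Enumeration p (count p)
enumerate {zero} p = (λ ()) , (λ {}) , λ ()
enumerate {suc n} p with p zero in p0 | enumerate (p ∘ suc)
... | false | g , g-inj , pg = suc ∘ g , g-inj ∘ suc-injective , pg
... | true | g , g-inj , pg = g′ , g′-inj , pg′
  where
  g′ : Fin (suc (count (p ∘ suc))) → Fin (suc n)
  g′ zero = zero
  g′ (suc i) = suc (g i)
  g′-inj : Injective _≡_ _≡_ g′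
  g′-inj {zero} {zero} _ = refl
  g′-inj {suc i} {suc j} e = cong suc (g-inj (suc-injective e))
  pg′ : ∀ i → p (g′ i) ≡ true
  pg′ zero = p0
  pg′ (suc i) = pg i

cellCount : ∀ {c r} → (Cell c r → Bool) → ℕ
cellCount P = sum λ y → count λ x → P (x , y)

cellCount-cover : ∀ {c r} {P : Cell c r → Bool} (Q R : Cell c r → Bool) →
                  (∀ u → P u ≡ true → Q u ∨ R u ≡ true) → cellCount P ≤ cellCount Q + cellCount R
cellCount-cover Q R P⊆Q∨R =
  ≤-trans (sum-mono-≤ λ y → count-cover _ _ λ x → P⊆Q∨R (x , y))
          (≤-reflexive (∑-distrib-+ (λ y → count λ x → Q (x , y)) (λ y → count λ x → R (x , y))))

cellCount+cellCount-not : ∀ {c r} (P : Cell c r → Bool) → cellCount P + cellCount (not ∘ P) ≡ r * c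
cellCount+cellCount-not {c} {r} P = begin
  cellCount P + cellCount (not ∘ P)                    ≡⟨ ∑-distrib-+ (λ y → count λ x → P (x , y)) _ ⟨
  sum (λ y → count (λ x → P (x , y)) + count (λ x → not (P (x , y))))
                                                       ≡⟨ sum-cong-≗ (λ y → count+count-not λ x → P (x , y)) ⟩
  sum {r} (λ _ → c)                                    ≡⟨ sum-const r ⟩
  r * c                                                ∎
  where
  open ≡-Reasoning
  sum-const : ∀ r → sum {r} (λ _ → c) ≡ r * c
  sum-const zero = refl
  sum-const (suc r) = cong (c +_) (sum-const r)

cellCount-by-columns : ∀ {c r} (P : Cell c r → Bool) → cellCount P ≡ sum λ x → count λ y → P (x , y)
cellCount-by-columns P = begin
  sum (λ y → count λ x → P (x , y))            ≡⟨ sum-cong-≗ (λ y → count≡sum λ x → P (x , y)) ⟩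
  sum (λ y → sum λ x → indicator (P (x , y)))  ≡⟨ ∑-comm (λ y x → indicator (P (x , y))) ⟩
  sum (λ x → sum λ y → indicator (P (x , y)))  ≡⟨ sum-cong-≗ (λ x → count≡sum λ y → P (x , y)) ⟨
  sum (λ x → count λ y → P (x , y))            ∎
  where open ≡-Reasoning

enumerate-cells : ∀ {c} r (P : Cell c r → Bool) → Enumeration P (cellCount P)
enumerate-cells zero P = (λ ()) , (λ {}) , λ ()
enumerate-cells (suc r) P = h ∘ splitAt a , splitAt-injective ∘ h-inj , P-h ∘ splitAt a
  where
  P₀ : Fin _ → Bool
  P₀ x = P (x , zero)
  P₊ : Cell _ r → Bool
  P₊ (x , y) = P (x , suc y)
  a : ℕ
  a = count P₀
  g₀ : Enumeration P₀ a
  g₀ = enumerate P₀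
  g₊ : Enumeration P₊ (cellCount P₊)
  g₊ = enumerate-cells r P₊
  h : Fin a ⊎ Fin (cellCount P₊) → Cell _ (suc r)
  h (inj₁ i) = proj₁ g₀ i , zero
  h (inj₂ i) = map₂ suc (proj₁ g₊ i)
  h-inj : Injective _≡_ _≡_ h
  h-inj {inj₁ i} {inj₁ j} e = cong inj₁ (proj₁ (proj₂ g₀) (cong proj₁ e))
  h-inj {inj₂ i} {inj₂ j} e =
    cong inj₂ (proj₁ (proj₂ g₊) (cong₂ _,_ (cong proj₁ e) (suc-injective (cong proj₂ e))))
  P-h : ∀ i → P (h i) ≡ true
  P-h (inj₁ i) = proj₂ (proj₂ g₀) i
  P-h (inj₂ i) = proj₂ (proj₂ g₊) i
  splitAt-injective : ∀ {i j} → splitAt a i ≡ splitAt a j → i ≡ j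
  splitAt-injective {i} {j} e =
    trans (sym (join-splitAt a _ i)) (trans (cong (join a _) e) (join-splitAt a _ j))

-- Independent sets in graphs of bounded degree

module _ {n : ℕ} (H : Fin n → Fin n → Bool) where

  Independent : (k : ℕ) → (Fin k → Fin n) → Set
  Independent k f = Injective _≡_ _≡_ f × (∀ i j → i ≢ j → H (f i) (f j) ≡ false)

  degreeIn : (Fin n → Bool) → Fin n → ℕ
  degreeIn S x = count λ z → H x z ∧ S z

  _∖N[_] : (Fin n → Bool) → Fin n → Fin n → Bool
  (S ∖N[ x ]) z = not (does (x ≟ z)) ∧ not (H x z) ∧ S z

  ∖N-spec : ∀ S x {z} → (S ∖N[ x ]) z ≡ true → x ≢ z × H x z ≡ false × S z ≡ true
  ∖N-spec S x {z} e with x ≟ z | H x z | S z | e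
  ... | no x≢z | false | true | _ = x≢z , refl , refl

  count-∖N : ∀ S x → count S ≤ suc (degreeIn S x) + count (S ∖N[ x ])
  count-∖N S x = begin
    count S
      ≤⟨ count-cover _ (S ∖N[ x ]) S⊆N[x]∪S∖N[x] ⟩
    count (λ z → does (x ≟ z) ∨ (H x z ∧ S z)) + count (S ∖N[ x ])
      ≤⟨ +-monoˡ-≤ _ (count-∨ (λ z → does (x ≟ z)) _) ⟩
    count (λ z → does (x ≟ z)) + degreeIn S x + count (S ∖N[ x ])
      ≤⟨ +-monoˡ-≤ _ (+-monoˡ-≤ _ (count-≡ x)) ⟩
    suc (degreeIn S x) + count (S ∖N[ x ])
      ∎
    where
    open ≤-Reasoning
    S⊆N[x]∪S∖N[x] : S ⊆ᵇ λ z → (does (x ≟ z) ∨ (H x z ∧ S z)) ∨ (S ∖N[ x ]) z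
    S⊆N[x]∪S∖N[x] z Sz rewrite Sz with x ≟ z | H x z
    ... | yes _ | _ = refl
    ... | no _ | true = refl
    ... | no _ | false = refl

  ∖N-sparse : ∀ {Δ} S x → (∀ {y} → S y ≡ true → degreeIn S y ≤ Δ) →
              ∀ {z} → (S ∖N[ x ]) z ≡ true → degreeIn (S ∖N[ x ]) z ≤ Δ
  ∖N-sparse S x sparse {z} e =
    ≤-trans (count-∧-monoʳ (H z) λ w → proj₂ ∘ proj₂ ∘ ∖N-spec S x)
            (sparse (proj₂ (proj₂ (∖N-spec S x e))))

  ∖N-large : ∀ {Δ k} S {x} → S x ≡ true → degreeIn S x ≤ Δ → suc k * suc Δ ≤ count S →
             k * suc Δ ≤ count (S ∖N[ x ])
  ∖N-large {Δ} S {x} Sx deg≤Δ large =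
    +-cancelˡ-≤ (suc Δ) _ _ (≤-trans large (≤-trans (count-∖N S x) (+-monoˡ-≤ _ (s≤s deg≤Δ))))

  -- Greedily pick x ∈ S and discard x with its at most Δ neighbours.
  independent-subset : (∀ x y → H x y ≡ H y x) → ∀ {Δ} k (S : Fin n → Bool) →
                       (∀ {x} → S x ≡ true → degreeIn S x ≤ Δ) → k * suc Δ ≤ count S →
                       Σ (Fin k → Fin n) λ f → Independent k f × (∀ i → S (f i) ≡ true)
  independent-subset H-sym zero S sparse large = (λ ()) , ((λ {}) , λ ()) , λ ()
  independent-subset H-sym (suc k) S sparse large with count>0⇒∃ S (≤-trans (s≤s z≤n) large)
  ... | x , Sx with independent-subset H-sym k (S ∖N[ x ]) (∖N-sparse S x sparse)
                                       (∖N-large {k = k} S Sx (sparse Sx) large)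
  ... | g , (g-inj , g-indep) , S∖g = f , (f-inj , f-indep) , Sf
    where
    f : Fin (suc k) → Fin n
    f zero = x
    f (suc i) = g i
    x≢g : ∀ i → x ≢ g i
    x≢g i = proj₁ (∖N-spec S x (S∖g i))
    f-inj : Injective _≡_ _≡_ f
    f-inj {zero} {zero} _ = refl
    f-inj {zero} {suc j} e = ⊥-elim (x≢g j e)
    f-inj {suc i} {zero} e = ⊥-elim (x≢g i (sym e))
    f-inj {suc i} {suc j} e = cong suc (g-inj e)
    f-indep : ∀ i j → i ≢ j → H (f i) (f j) ≡ false
    f-indep zero zero i≢j = ⊥-elim (i≢j refl)
    f-indep zero (suc j) _ = proj₁ (proj₂ (∖N-spec S x (S∖g j)))
    f-indep (suc i) zero _ = trans (H-sym (g i) x) (proj₁ (proj₂ (∖N-spec S x (S∖g i))))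
    f-indep (suc i) (suc j) i≢j = g-indep i j (i≢j ∘ cong suc)
    Sf : ∀ i → S (f i) ≡ true
    Sf zero = Sx
    Sf (suc i) = proj₂ (proj₂ (∖N-spec S x (S∖g i)))

  sparse-small : (∀ x y → H x y ≡ H y x) → ∀ {Δ} k (S : Fin n → Bool) →
                 (∀ {x} → S x ≡ true → degreeIn S x ≤ Δ) → ¬ (Σ (Fin k → Fin n) (Independent k)) →
                 count S ≤ k * suc Δ
  sparse-small H-sym {Δ} k S sparse no-independent with k * suc Δ ≤? count S
  ... | no small = <⇒≤ (≰⇒> small)
  ... | yes large = ⊥-elim (no-independent (map₂ proj₁ (independent-subset H-sym k S sparse large)))

-- Pruning the grid

module Pruning {N : ℕ} (G : GridSubgraph N N) (Δ : ℕ) where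

  core : ℕ → Cell N N → Bool
  rowDegree columnDegree : ℕ → Cell N N → ℕ

  core zero _ = true
  core (suc r) u = core r u ∧ does (suc Δ ≤? rowDegree r u) ∧ does (suc Δ ≤? columnDegree r u)

  rowDegree r (x , y) = count λ x′ → E G (x , y) (x′ , y) ∧ core r (x′ , y)
  columnDegree r (x , y) = count λ y′ → E G (x , y) (x , y′) ∧ core r (x , y′)

  core-suc⇒core : ∀ r u → core (suc r) u ≡ true → core r u ≡ true
  core-suc⇒core r u = proj₁ ∘ ∧-≡-true (core r u)

  core-suc⇒rowDegree : ∀ r u → core (suc r) u ≡ true → suc Δ ≤ rowDegree r u
  core-suc⇒rowDegree r u e =
    does-true⇒ (_ ≤? rowDegree r u) (proj₁ (∧-≡-true _ (proj₂ (∧-≡-true (core r u) e))))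

  core-suc⇒columnDegree : ∀ r u → core (suc r) u ≡ true → suc Δ ≤ columnDegree r u
  core-suc⇒columnDegree r u e =
    does-true⇒ (_ ≤? columnDegree r u) (proj₂ (∧-≡-true _ (proj₂ (∧-≡-true (core r u) e))))

  core-suc⇒Δ<N : ∀ r u → core (suc r) u ≡ true → Δ < N
  core-suc⇒Δ<N r u e = ≤-trans (core-suc⇒rowDegree r u e) (count≤n _)

  rowSparse columnSparse : ℕ → Cell N N → Bool
  rowSparse r u = core r u ∧ not (does (suc Δ ≤? rowDegree r u))
  columnSparse r u = core r u ∧ not (does (suc Δ ≤? columnDegree r u))

  rowSparse⇒rowDegree≤Δ : ∀ r u → rowSparse r u ≡ true → rowDegree r u ≤ Δ
  rowSparse⇒rowDegree≤Δ r u e =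
    ≤-pred (≰⇒> (does-false⇒ (_ ≤? rowDegree r u) (not-≡-true (proj₂ (∧-≡-true (core r u) e)))))

  columnSparse⇒columnDegree≤Δ : ∀ r u → columnSparse r u ≡ true → columnDegree r u ≤ Δ
  columnSparse⇒columnDegree≤Δ r u e =
    ≤-pred (≰⇒> (does-false⇒ (_ ≤? columnDegree r u) (not-≡-true (proj₂ (∧-≡-true (core r u) e)))))

  pruned⊆sparse : ∀ r u → not (core (suc r) u) ≡ true →
                  not (core r u) ∨ (rowSparse r u ∨ columnSparse r u) ≡ true
  pruned⊆sparse r u e with core r u | does (suc Δ ≤? rowDegree r u) | does (suc Δ ≤? columnDegree r u)
  ... | false | _ | _ = refl
  ... | true | false | _ = refl
  ... | true | true | false = refl
  ... | true | true | true = e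

  module _ {k : ℕ} (no-coclique : ¬ HasCoclique G k) where

    rowSparse-small : ∀ r y → count (λ x → rowSparse r (x , y)) ≤ k * suc Δ
    rowSparse-small r y = sparse-small H (λ x x′ → E-sym G (x , y) (x′ , y)) k S sparse
      λ (f , f-inj , f-indep) → no-coclique (inj₁ (y , f , f-inj , f-indep))
      where
      S : Fin N → Bool
      S x = rowSparse r (x , y)
      H : Fin N → Fin N → Bool
      H x x′ = E G (x , y) (x′ , y)
      sparse : ∀ {x} → S x ≡ true → degreeIn H S x ≤ Δ
      sparse {x} Sx = ≤-trans (count-∧-monoʳ (H x) λ x′ → proj₁ ∘ ∧-≡-true (core r (x′ , y)))
                              (rowSparse⇒rowDegree≤Δ r (x , y) Sx)

    columnSparse-small : ∀ r x → count (λ y → columnSparse r (x , y)) ≤ k * suc Δ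
    columnSparse-small r x = sparse-small H (λ y y′ → E-sym G (x , y) (x , y′)) k S sparse
      λ (f , f-inj , f-indep) → no-coclique (inj₂ (x , f , f-inj , f-indep))
      where
      S : Fin N → Bool
      S y = columnSparse r (x , y)
      H : Fin N → Fin N → Bool
      H y y′ = E G (x , y) (x , y′)
      sparse : ∀ {y} → S y ≡ true → degreeIn H S y ≤ Δ
      sparse {y} Sy = ≤-trans (count-∧-monoʳ (H y) λ y′ → proj₁ ∘ ∧-≡-true (core r (x , y′)))
                              (columnSparse⇒columnDegree≤Δ r (x , y) Sy)

    core-complement : ∀ r → cellCount (not ∘ core r) ≤ r * (N * (k * suc Δ) + N * (k * suc Δ))
    core-complement zero =
      ≤-trans (sum≤n*a {n = N} λ _ → ≤-reflexive (count-false {N})) (≤-reflexive (*-zeroʳ N))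
    core-complement (suc r) = begin
      cellCount (not ∘ core (suc r))
        ≤⟨ cellCount-cover (not ∘ core r) _ (pruned⊆sparse r) ⟩
      cellCount (not ∘ core r) + cellCount (λ u → rowSparse r u ∨ columnSparse r u)
        ≤⟨ +-mono-≤ (core-complement r) (cellCount-cover (rowSparse r) (columnSparse r) λ _ e → e) ⟩
      r * B + (cellCount (rowSparse r) + cellCount (columnSparse r))
        ≤⟨ +-monoʳ-≤ (r * B) (+-mono-≤ (sum≤n*a (rowSparse-small r))
                                         (≤-trans (≤-reflexive (cellCount-by-columns (columnSparse r)))
                                                  (sum≤n*a (columnSparse-small r)))) ⟩
      r * B + B
        ≡⟨ +-comm (r * B) B ⟩
      suc r * B ∎
      where
      open ≤-Reasoning
      B : ℕ
      B = N * (k * suc Δ) + N * (k * suc Δ)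

-- Walks, paths and detours

module _ {A : Set} {R : A → A → Set} where

  first-exit : ∀ {P : A → Set} → Decidable P → ∀ {a b} → Star R a b → P a → ¬ P b →
               ∃₂ λ p q → P p × ¬ P q × R p q
  first-exit P? ε Pa ¬Pb = ⊥-elim (¬Pb Pa)
  first-exit P? (_◅_ {j = b} ab w) Pa ¬Pc with P? b
  ... | yes Pb = first-exit P? w Pb ¬Pc
  ... | no ¬Pb = _ , b , Pa , ¬Pb , ab

  vertices : ∀ {a b} → Star R a b → List A
  vertices {a} ε = a ∷ []
  vertices {a} (_ ◅ w) = a ∷ vertices w

  IsPath : ∀ {a b} → Star R a b → Set
  IsPath ε = ⊤
  IsPath {a} (_ ◅ w) = a ∉ vertices w × IsPath w

  steps : ∀ {a b} → Star R a b → ℕ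
  steps ε = zero
  steps (_ ◅ w) = suc (steps w)

  vertex : ∀ {a b} (w : Star R a b) → Fin (suc (steps w)) → A
  vertex {a} w zero = a
  vertex (_ ◅ w) (suc i) = vertex w i

  vertex∈vertices : ∀ {a b} (w : Star R a b) i → vertex w i ∈ vertices w
  vertex∈vertices ε zero = here refl
  vertex∈vertices (_ ◅ w) zero = here refl
  vertex∈vertices (_ ◅ w) (suc i) = there (vertex∈vertices w i)

  vertex-injective : ∀ {a b} (w : Star R a b) → IsPath w → Injective _≡_ _≡_ (vertex w)
  vertex-injective ε _ {zero} {zero} _ = refl
  vertex-injective (_ ◅ w) _ {zero} {zero} _ = refl
  vertex-injective (_ ◅ w) (a∉w , _) {zero} {suc j} e =
    ⊥-elim (a∉w (subst (_∈ vertices w) (sym e) (vertex∈vertices w j)))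
  vertex-injective (_ ◅ w) (a∉w , _) {suc i} {zero} e =
    ⊥-elim (a∉w (subst (_∈ vertices w) e (vertex∈vertices w i)))
  vertex-injective (_ ◅ w) (_ , path) {suc i} {suc j} e = cong suc (vertex-injective w path e)

  vertex-step : ∀ {a b} (w : Star R a b) (i : Fin (steps w)) → R (vertex w (inject₁ i)) (vertex w (suc i))
  vertex-step (ab ◅ w) zero = ab
  vertex-step (_ ◅ w) (suc i) = vertex-step w i

  vertex-last : ∀ {a b} (w : Star R a b) → vertex w (fromℕ (steps w)) ≡ b
  vertex-last ε = refl
  vertex-last (_ ◅ w) = vertex-last w

  module _ (_≟_ : (x y : A) → Dec (x ≡ y)) where

    path-suffix : ∀ {b c x} (w : Star R b c) → IsPath w → x ∈ vertices w → Σ (Star R x c) IsPath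
    path-suffix ε _ (here refl) = ε , tt
    path-suffix (ab ◅ w) path (here refl) = ab ◅ w , path
    path-suffix (_ ◅ w) (_ , path) (there x∈w) = path-suffix w path x∈w

    loop-erase : ∀ {a b} → Star R a b → Σ (Star R a b) IsPath
    loop-erase ε = ε , tt
    loop-erase {a} (ab ◅ w) with loop-erase w
    ... | w′ , path with ∈? _≟_ a (vertices w′)
    ...   | yes a∈w′ = path-suffix w′ path a∈w′
    ...   | no a∉w′ = ab ◅ w′ , a∉w′ , path

E-irreflexive : ∀ {c r} (H : GridSubgraph c r) {u w} → E H u w ≡ true → u ≢ w
E-irreflexive H {u} uw refl with () ← trans (sym uw) (E-irrefl H u)

module _ {c r : ℕ} (T : GridSubgraph c r) where

  EdgeWithin : (Cell c r → Set) → Cell c r → Cell c r → Set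
  EdgeWithin P u w = E T u w ≡ true × P u × P w

  walk⇒star : ∀ {P u w} → WalkIn (E T) P u w → Star (EdgeWithin P) u w
  walk⇒star (here _) = ε
  walk⇒star (step Pu uv w) = (uv , Pu , head w) ◅ walk⇒star w
    where
    head : ∀ {P a b} → WalkIn (E T) P a b → P a
    head (here Pa) = Pa
    head (step Pa _ _) = Pa

  Detour : Cell c r → Cell c r → Cell c r → Cell c r → Set
  Detour q p a b = E T a b ≡ true × ¬ (a ≡ q × b ≡ p)

  -- A loop-erased detour from q back to p, closed by the edge p q, is a cycle.
  no-detour : ¬ Cycle T → ∀ {p q} → E T p q ≡ true → q ≢ p → ¬ Star (Detour q p) q p
  no-detour acyclic {p} {q} pq q≢p w with loop-erase (≡-dec _≟_ _≟_) w
  ... | ε , _ = q≢p refl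
  ... | (_ , not-pq) ◅ ε , _ = not-pq (refl , refl)
  ... | w′@(_ ◅ _ ◅ w″) , path =
    acyclic (steps w″ , vertex w′ , vertex-injective w′ path , proj₁ ∘ vertex-step w′ ,
             subst (λ z → E T z q ≡ true) (sym (vertex-last w′)) pq)

  module _ {P : Cell c r → Set} {q p : Cell c r} where

    detour-avoiding-target : (∀ {w} → P w → w ≢ p) →
                             ∀ {a b} → Star (EdgeWithin P) a b → Star (Detour q p) a b
    detour-avoiding-target P⇒≢p = Star-map λ (ab , _ , Pb) → ab , λ (_ , b≡p) → P⇒≢p Pb b≡p

    detour-avoiding-source : (∀ {w} → P w → w ≢ q) →
                             ∀ {a b} → Star (EdgeWithin P) a b → Star (Detour q p) a b
    detour-avoiding-source P⇒≢q = Star-map λ (ab , Pa , _) → ab , λ (a≡q , _) → P⇒≢q Pa a≡q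

  reverse-within : ∀ {P a b} → Star (EdgeWithin P) a b → Star (EdgeWithin P) b a
  reverse-within = Star-reverse λ {a} {b} (ab , Pa , Pb) → trans (E-sym T b a) ab , Pb , Pa

-- Partial injections

Assigned : Maybe A → Set
Assigned m = ∃ λ X → m ≡ just X

assigned? : (m : Maybe A) → Dec (Assigned m)
assigned? (just X) = yes (X , refl)
assigned? nothing = no λ ()

≢nothing⇒assigned : (m : Maybe A) → m ≢ nothing → Assigned m
≢nothing⇒assigned (just X) _ = X , refl
≢nothing⇒assigned nothing m≢nothing = ⊥-elim (m≢nothing refl)

∈-mapMaybe⁺ : ∀ {B : Set} (f : A → Maybe B) {x y} {xs : List A} →
              x ∈ xs → f x ≡ just y → y ∈ mapMaybe f xs
∈-mapMaybe⁺ f {xs = x ∷ xs} (here refl) fx rewrite fx = here refl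
∈-mapMaybe⁺ f {xs = x′ ∷ xs} (there x∈xs) fx with f x′
... | just _ = there (∈-mapMaybe⁺ f x∈xs fx)
... | nothing = ∈-mapMaybe⁺ f x∈xs fx

update : (Fin n → Maybe A) → Fin n → A → Fin n → Maybe A
update f i X j with j ≟ i
... | yes _ = just X
... | no _ = f j

update-at : (f : Fin n → Maybe A) (i : Fin n) (X : A) → update f i X i ≡ just X
update-at f i X with i ≟ i
... | yes _ = refl
... | no i≢i = ⊥-elim (i≢i refl)

update-other : (f : Fin n → Maybe A) {i : Fin n} (X : A) {j : Fin n} → j ≢ i → update f i X j ≡ f j
update-other f {i} X {j} j≢i with j ≟ i
... | yes j≡i = ⊥-elim (j≢i j≡i)
... | no _ = refl

update-inv : (f : Fin n → Maybe A) (i : Fin n) (X : A) (j : Fin n) {Y : A} →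
             update f i X j ≡ just Y → (j ≡ i × Y ≡ X) ⊎ f j ≡ just Y
update-inv f i X j e with j ≟ i
... | yes j≡i = inj₁ (j≡i , sym (just-injective e))
... | no _ = inj₂ e

update-nothing-inv : (i : Fin n) (X : A) (j : Fin n) {Y : A} →
                     update (λ _ → nothing) i X j ≡ just Y → j ≡ i × Y ≡ X
update-nothing-inv i X j e with update-inv _ i X j e
... | inj₁ j≡i,Y≡X = j≡i,Y≡X
... | inj₂ ()

module _ {N : ℕ} where

  record PartialInjection (n : ℕ) (i₀ : Fin n) (X₀ : Fin N) (F : List (Fin N)) : Set where
    field
      at : Fin n → Maybe (Fin N)
      at-root : at i₀ ≡ just X₀
      at-injective : ∀ {i j X} → at i ≡ just X → at j ≡ just X → i ≡ j
      at-avoids : ∀ {i X} → at i ≡ just X → i ≢ i₀ → X ∉ F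

    image : List (Fin N)
    image = mapMaybe at (allFin n)

    ∈-image : ∀ {i X} → at i ≡ just X → X ∈ image
    ∈-image = ∈-mapMaybe⁺ at (∈-allFin _)

    length-image : length image ≤ n
    length-image = ≤-trans (length-mapMaybe at (allFin n)) (≤-reflexive (length-tabulate (λ i → i)))

    length-++-image : ∀ (F′ : List (Fin N)) → length (F′ ++ image) ≤ length F′ + n
    length-++-image F′ = ≤-trans (≤-reflexive (length-++ F′)) (+-monoʳ-≤ (length F′) length-image)

    unassigned : ℕ
    unassigned = count (is-nothing ∘ at)

  open PartialInjection public

  module _ {i₀ : Fin n} {X₀ : Fin N} {F : List (Fin N)} where

    singleton : PartialInjection n i₀ X₀ F
    singleton = record
      { at = update (λ _ → nothing) i₀ X₀
      ; at-root = update-at _ i₀ X₀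
      ; at-injective = λ {i} {j} ei ej → trans (proj₁ (update-nothing-inv i₀ X₀ i ei))
                                                (sym (proj₁ (update-nothing-inv i₀ X₀ j ej)))
      ; at-avoids = λ {i} ei i≢i₀ → ⊥-elim (i≢i₀ (proj₁ (update-nothing-inv i₀ X₀ i ei)))
      }

    module _ (p : PartialInjection n i₀ X₀ F) {i : Fin n} (unset : at p i ≡ nothing)
             {X : Fin N} (X-fresh : X ∉ F ++ image p) where

      assign : PartialInjection n i₀ X₀ F
      assign = record
        { at = update (at p) i X
        ; at-root = trans (update-other (at p) X i₀≢i) (at-root p)
        ; at-injective = injective
        ; at-avoids = avoids
        }
        where
        i₀≢i : i₀ ≢ i
        i₀≢i refl with () ← trans (sym unset) (at-root p)
        X-unused : ∀ {j} → at p j ≢ just X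
        X-unused e = X-fresh (∈-++⁺ʳ F (∈-image p e))
        injective : ∀ {j k Y} → update (at p) i X j ≡ just Y → update (at p) i X k ≡ just Y → j ≡ k
        injective {j} {k} ej ek with update-inv (at p) i X j ej | update-inv (at p) i X k ek
        ... | inj₁ (j≡i , _) | inj₁ (k≡i , _) = trans j≡i (sym k≡i)
        ... | inj₁ (_ , refl) | inj₂ ek′ = ⊥-elim (X-unused ek′)
        ... | inj₂ ej′ | inj₁ (_ , refl) = ⊥-elim (X-unused ej′)
        ... | inj₂ ej′ | inj₂ ek′ = at-injective p ej′ ek′
        avoids : ∀ {j Y} → update (at p) i X j ≡ just Y → j ≢ i₀ → Y ∉ F
        avoids {j} ej j≢i₀ with update-inv (at p) i X j ej
        ... | inj₁ (_ , refl) = X-fresh ∘ ∈-++⁺ˡ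
        ... | inj₂ ej′ = at-avoids p ej′ j≢i₀

      assign-at : at assign i ≡ just X
      assign-at = update-at (at p) i X

      assign-preserves : ∀ {j Y} → at p j ≡ just Y → at assign j ≡ just Y
      assign-preserves {j} e = trans (update-other (at p) X j≢i) e
        where
        j≢i : j ≢ i
        j≢i refl with () ← trans (sym unset) e

      assign-inv : ∀ {j Y} → at assign j ≡ just Y → (j ≡ i × Y ≡ X) ⊎ at p j ≡ just Y
      assign-inv {j} = update-inv (at p) i X j

      unassigned-assign : unassigned assign < unassigned p
      unassigned-assign = count-< shrinks (cong is-nothing assign-at) (cong is-nothing unset)
        where
        shrinks : (is-nothing ∘ at assign) ⊆ᵇ (is-nothing ∘ at p)
        shrinks j e with at p j in ej
        ... | nothing = refl
        ... | just Y with () ← subst (λ m → is-nothing m ≡ true) (assign-preserves ej) e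

    Completion : PartialInjection n i₀ X₀ F → Set
    Completion p = Σ (Fin n → Fin N) λ φ → Injective _≡_ _≡_ φ
                   × (∀ {i X} → at p i ≡ just X → φ i ≡ X) × (∀ i → i ≢ i₀ → φ i ∉ F)

    total⇒completion : (p : PartialInjection n i₀ X₀ F) → (∀ i → Assigned (at p i)) → Completion p
    total⇒completion p total = φ , φ-injective , (λ e → just-injective (trans (sym (proj₂ (total _))) e)) ,
                               λ i → at-avoids p (proj₂ (total i))
      where
      φ = proj₁ ∘ total
      φ-injective : Injective _≡_ _≡_ φ
      φ-injective {i} {j} e =
        at-injective p (proj₂ (total i)) (subst (λ X → at p j ≡ just X) (sym e) (proj₂ (total j)))

    completion-assign : ∀ p {i} (unset : at p i ≡ nothing) {X} (X-fresh : X ∉ F ++ image p) →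
                        Completion (assign p unset X-fresh) → Completion p
    completion-assign p unset X-fresh (φ , φ-injective , φ-agrees , φ-avoids) =
      φ , φ-injective , φ-agrees ∘ assign-preserves p unset X-fresh , φ-avoids

    complete-with : ∀ k (p : PartialInjection n i₀ X₀ F) → unassigned p ≤ k → length F + n < N →
                    Completion p
    complete-with k p ≤k room with any? (λ i → ≡-dec-Maybe _≟_ (at p i) nothing)
    ... | no none = total⇒completion p λ i → ≢nothing⇒assigned (at p i) (λ e → none (i , e))
    ... | yes (i , unset) with k
    ...   | zero = ⊥-elim (<⇒≱ (∃⇒count>0 (is-nothing ∘ at p) (cong is-nothing unset)) ≤k)
    ...   | suc k′ = completion-assign p unset X-fresh (complete-with k′ p′ ≤k′ room)
      where
      room′ : length (F ++ image p) < count {N} (λ _ → true)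
      room′ = ≤-<-trans (length-++-image p F) (<-≤-trans room (≤-reflexive (sym count-true)))
      X-fresh : proj₁ (fresh (λ _ → true) (F ++ image p) room′) ∉ F ++ image p
      X-fresh = proj₂ (proj₂ (fresh (λ _ → true) (F ++ image p) room′))
      p′ : PartialInjection n i₀ X₀ F
      p′ = assign p unset X-fresh
      ≤k′ : unassigned p′ ≤ k′
      ≤k′ = ≤-pred (≤-trans (unassigned-assign p unset X-fresh) ≤k)

    complete : (p : PartialInjection n i₀ X₀ F) → length F + n < N → Completion p
    complete p = complete-with (unassigned p) p ≤-refl

-- Embedding one copy of T

module Embed {cT rT : ℕ} (T : GridSubgraph cT rT) (simple : IsSimple T) (tree : IsTree T)
               {s : Fin cT} {t : Fin rT} (v-vertex : IsVertex T (s , t))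
               {N : ℕ} (G : GridSubgraph N N) (Δ : ℕ) (a b : Fin N) (Fc Fr : List (Fin N))
               (room-columns : length Fc + cT ≤ Δ) (room-rows : length Fr + rT ≤ Δ) where

  open Pruning G Δ

  v : Cell cT rT
  v = s , t

  rows-connected : ∀ y → ConnectedIn (E T) λ u → IsVertex T u × proj₂ u ≡ y
  rows-connected = proj₁ simple

  columns-connected : ∀ x → ConnectedIn (E T) λ u → IsVertex T u × proj₁ u ≡ x
  columns-connected = proj₂ simple

  acyclic : ¬ Cycle T
  acyclic = proj₂ tree

  record Placement : Set where
    constructor placement
    field
      columns : PartialInjection cT s a Fc
      rows : PartialInjection rT t b Fr

  open Placement

  infix 4 _⊢_↦_
  _⊢_↦_ : Placement → Cell cT rT → Cell N N → Set
  P ⊢ (x , y) ↦ (X , Y) = at (columns P) x ≡ just X × at (rows P) y ≡ just Y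

  Placed : Placement → Cell cT rT → Set
  Placed P u = IsVertex T u × ∃ (P ⊢ u ↦_)

  placed? : ∀ P u → Dec (Placed P u)
  placed? P (x , y) with V T (x , y) ≟ᵇ true | assigned? (at (columns P) x) | assigned? (at (rows P) y)
  ... | yes xy | yes (X , x↦X) | yes (Y , y↦Y) = yes (xy , (X , Y) , x↦X , y↦Y)
  ... | no ¬xy | _ | _ = no (¬xy ∘ proj₁)
  ... | _ | no ¬x | _ = no λ (_ , _ , x↦X , _) → ¬x (_ , x↦X)
  ... | _ | _ | no ¬y = no λ (_ , _ , _ , y↦Y) → ¬y (_ , y↦Y)

  unassigned-lines : Placement → ℕ
  unassigned-lines P = unassigned (columns P) + unassigned (rows P)

  -- r counts the pruning rounds still available; each later step places its new image one round lower.
  record Invariant (P : Placement) (r : ℕ) : Set where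
    field
      edges : ∀ {u w U W} → P ⊢ u ↦ U → P ⊢ w ↦ W → E T u w ≡ true → E G U W ≡ true
      in-core : ∀ {u U} → IsVertex T u → P ⊢ u ↦ U → core r U ≡ true
      column-placed : ∀ {x y} → IsVertex T (x , y) → Assigned (at (columns P) x) →
                      ∃ λ y′ → Placed P (x , y′)
      row-placed : ∀ {x y} → IsVertex T (x , y) → Assigned (at (rows P) y) → ∃ λ x′ → Placed P (x′ , y)
      connected : ∀ {u} → Placed P u → Star (EdgeWithin T (Placed P)) v u

  open Invariant

  column-unset⇒unplaced : ∀ {P x y} → at (columns P) x ≡ nothing → ¬ Placed P (x , y)
  column-unset⇒unplaced x-unset (_ , _ , x↦ , _) with () ← trans (sym x-unset) x↦

  row-unset⇒unplaced : ∀ {P x y} → at (rows P) y ≡ nothing → ¬ Placed P (x , y)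
  row-unset⇒unplaced y-unset (_ , _ , _ , y↦) with () ← trans (sym y-unset) y↦

  module _ {P : Placement} {r : ℕ} (inv : Invariant P r) where

    placed-path : ∀ {u w} → Placed P u → Placed P w → Star (EdgeWithin T (Placed P)) u w
    placed-path u-placed w-placed = reverse-within T (connected inv u-placed) ◅◅ connected inv w-placed

    placed-detour : ∀ {q p u w} → ¬ Placed P q → Placed P u → Placed P w → Star (Detour T q p) u w
    placed-detour q-unplaced u-placed w-placed =
      detour-avoiding-source T (λ w-placed w≡q → q-unplaced (subst (Placed P) w≡q w-placed))
                             (placed-path u-placed w-placed)

    only-placed-neighbour : ∀ {p q q′} → Placed P p → ¬ Placed P q → E T p q ≡ true →
                            Placed P q′ → E T q q′ ≡ true → q′ ≡ p
    only-placed-neighbour {p} {q} {q′} p-placed q-unplaced pq q′-placed qq′ with ≡-dec _≟_ _≟_ q′ p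
    ... | yes q′≡p = q′≡p
    ... | no q′≢p = ⊥-elim (no-detour T acyclic pq (λ { refl → q-unplaced p-placed })
                              ((qq′ , q′≢p ∘ proj₂) ◅ placed-detour q-unplaced q′-placed p-placed))

    -- If the column of q met a second assigned row y′ ≠ y, then going along that column to row y′,
    -- along row y′ to a placed vertex, and back through the placed vertices to p would be a detour.
    new-column-meets-one-row : ∀ {xp xq y} → Placed P (xp , y) → at (columns P) xq ≡ nothing →
                               E T (xp , y) (xq , y) ≡ true →
                               ∀ {y′} → Assigned (at (rows P) y′) → IsVertex T (xq , y′) → y′ ≡ y
    new-column-meets-one-row {xp} {xq} {y} p-placed xq-unset pq {y′} y′-assigned q′-vertex with y′ ≟ y
    ... | yes y′≡y = y′≡y
    ... | no y′≢y = ⊥-elim (no-detour T acyclic pq (λ { refl → q-unplaced p-placed })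
                              (along-column ◅◅ along-row ◅◅ placed-detour q-unplaced q″-placed p-placed))
      where
      q-unplaced : ¬ Placed P (xq , y)
      q-unplaced = column-unset⇒unplaced {P} xq-unset
      x″ : Fin cT
      x″ = proj₁ (row-placed inv q′-vertex y′-assigned)
      q″-placed : Placed P (x″ , y′)
      q″-placed = proj₂ (row-placed inv q′-vertex y′-assigned)
      along-column : Star (Detour T (xq , y) (xp , y)) (xq , y) (xq , y′)
      along-column = detour-avoiding-target T
        (λ (_ , in-xq) w≡p →
           q-unplaced (subst (λ x → Placed P (x , y)) (trans (sym (cong proj₁ w≡p)) in-xq) p-placed))
        (walk⇒star T (columns-connected xq _ _ (proj₂ (E-vert T _ _ pq) , refl) (q′-vertex , refl)))
      along-row : Star (Detour T (xq , y) (xp , y)) (xq , y′) (x″ , y′)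
      along-row = detour-avoiding-target T (λ (_ , in-y′) w≡p → y′≢y (trans (sym in-y′) (cong proj₂ w≡p)))
        (walk⇒star T (rows-connected y′ _ _ (q′-vertex , refl) (proj₁ q″-placed , refl)))

    new-row-meets-one-column : ∀ {x yp yq} → Placed P (x , yp) → at (rows P) yq ≡ nothing →
                               E T (x , yp) (x , yq) ≡ true →
                               ∀ {x′} → Assigned (at (columns P) x′) → IsVertex T (x′ , yq) → x′ ≡ x
    new-row-meets-one-column {x} {yp} {yq} p-placed yq-unset pq {x′} x′-assigned q′-vertex with x′ ≟ x
    ... | yes x′≡x = x′≡x
    ... | no x′≢x = ⊥-elim (no-detour T acyclic pq (λ { refl → q-unplaced p-placed })
                              (along-row ◅◅ along-column ◅◅ placed-detour q-unplaced q″-placed p-placed))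
      where
      q-unplaced : ¬ Placed P (x , yq)
      q-unplaced = row-unset⇒unplaced {P} yq-unset
      y″ : Fin rT
      y″ = proj₁ (column-placed inv q′-vertex x′-assigned)
      q″-placed : Placed P (x′ , y″)
      q″-placed = proj₂ (column-placed inv q′-vertex x′-assigned)
      along-row : Star (Detour T (x , yq) (x , yp)) (x , yq) (x′ , yq)
      along-row = detour-avoiding-target T
        (λ (_ , in-yq) w≡p →
           q-unplaced (subst (λ y → Placed P (x , y)) (trans (sym (cong proj₂ w≡p)) in-yq) p-placed))
        (walk⇒star T (rows-connected yq _ _ (proj₂ (E-vert T _ _ pq) , refl) (q′-vertex , refl)))
      along-column : Star (Detour T (x , yq) (x , yp)) (x′ , yq) (x′ , y″)
      along-column = detour-avoiding-target T (λ (_ , in-x′) w≡p → x′≢x (trans (sym in-x′) (cong proj₁ w≡p)))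
        (walk⇒star T (columns-connected x′ _ _ (q′-vertex , refl) (proj₁ q″-placed , refl)))

  ↦-functional : ∀ P {u U U′} → P ⊢ u ↦ U → P ⊢ u ↦ U′ → U ≡ U′
  ↦-functional _ (x↦X , y↦Y) (x↦X′ , y↦Y′) =
    cong₂ _,_ (just-injective (trans (sym x↦X) x↦X′)) (just-injective (trans (sym y↦Y) y↦Y′))

  module Grow {P P′ : Placement} {r : ℕ} (inv : Invariant P (suc r))
              {p q : Cell cT rT} {U₀ Q : Cell N N}
              (p-vertex : IsVertex T p) (p↦U₀ : P ⊢ p ↦ U₀) (q-unplaced : ¬ Placed P q)
              (pq : E T p q ≡ true)
              (q↦Q : P′ ⊢ q ↦ Q) (U₀Q : E G U₀ Q ≡ true) (Q-core : core r Q ≡ true)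
              (preserves : ∀ {u U} → P ⊢ u ↦ U → P′ ⊢ u ↦ U)
              (only-q-new : ∀ {u U} → IsVertex T u → P′ ⊢ u ↦ U → (u ≡ q × U ≡ Q) ⊎ P ⊢ u ↦ U)
              (columns-grow : ∀ {x} → Assigned (at (columns P′) x) →
                              Assigned (at (columns P) x) ⊎ x ≡ proj₁ q)
              (rows-grow : ∀ {y} → Assigned (at (rows P′) y) → Assigned (at (rows P) y) ⊎ y ≡ proj₂ q)
              where

    p-placed : Placed P p
    p-placed = p-vertex , U₀ , p↦U₀

    q-vertex : IsVertex T q
    q-vertex = proj₂ (E-vert T p q pq)

    placed-preserved : ∀ {u} → Placed P u → Placed P′ u
    placed-preserved (u-vertex , U , u↦U) = u-vertex , U , preserves u↦U

    neighbour-of-q : ∀ {w W} → IsVertex T w → P ⊢ w ↦ W → E T q w ≡ true → E G Q W ≡ true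
    neighbour-of-q w-vertex w↦W qw with only-placed-neighbour inv p-placed q-unplaced pq (w-vertex , _ , w↦W) qw
    ... | refl rewrite ↦-functional P w↦W p↦U₀ = trans (E-sym G Q U₀) U₀Q

    grow : Invariant P′ r
    grow = record
      { edges = edges′
      ; in-core = in-core′
      ; column-placed = column-placed′
      ; row-placed = row-placed′
      ; connected = connected′
      }
      where
      edges′ : ∀ {u w U W} → P′ ⊢ u ↦ U → P′ ⊢ w ↦ W → E T u w ≡ true → E G U W ≡ true
      edges′ {u} {w} u↦U w↦W uw
        with only-q-new (proj₁ (E-vert T u w uw)) u↦U | only-q-new (proj₂ (E-vert T u w uw)) w↦W
      ... | inj₂ u↦U | inj₂ w↦W = edges inv u↦U w↦W uw
      ... | inj₁ (refl , refl) | inj₂ w↦W = neighbour-of-q (proj₂ (E-vert T u w uw)) w↦W uw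
      ... | inj₂ u↦U | inj₁ (refl , refl) =
        trans (E-sym G _ _) (neighbour-of-q (proj₁ (E-vert T u w uw)) u↦U (trans (E-sym T w u) uw))
      ... | inj₁ (refl , _) | inj₁ (refl , _) = ⊥-elim (E-irreflexive T uw refl)
      in-core′ : ∀ {u U} → IsVertex T u → P′ ⊢ u ↦ U → core r U ≡ true
      in-core′ u-vertex u↦U with only-q-new u-vertex u↦U
      ... | inj₁ (_ , refl) = Q-core
      ... | inj₂ u↦U = core-suc⇒core r _ (in-core inv u-vertex u↦U)
      column-placed′ : ∀ {x y} → IsVertex T (x , y) → Assigned (at (columns P′) x) →
                       ∃ λ y′ → Placed P′ (x , y′)
      column-placed′ xy-vertex x-assigned with columns-grow x-assigned
      ... | inj₁ x-assigned = map₂ placed-preserved (column-placed inv xy-vertex x-assigned)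
      ... | inj₂ refl = proj₂ q , q-vertex , Q , q↦Q
      row-placed′ : ∀ {x y} → IsVertex T (x , y) → Assigned (at (rows P′) y) →
                    ∃ λ x′ → Placed P′ (x′ , y)
      row-placed′ xy-vertex y-assigned with rows-grow y-assigned
      ... | inj₁ y-assigned = map₂ placed-preserved (row-placed inv xy-vertex y-assigned)
      ... | inj₂ refl = proj₁ q , q-vertex , Q , q↦Q
      lift : ∀ {u w} → Star (EdgeWithin T (Placed P)) u w → Star (EdgeWithin T (Placed P′)) u w
      lift = Star-map λ (e , u-placed , w-placed) → e , placed-preserved u-placed , placed-preserved w-placed
      connected′ : ∀ {u} → Placed P′ u → Star (EdgeWithin T (Placed P′)) v u
      connected′ (u-vertex , U , u↦U) with only-q-new u-vertex u↦U
      ... | inj₁ (refl , refl) =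
        lift (connected inv p-placed) ◅◅ ((pq , placed-preserved p-placed , q-vertex , Q , q↦Q) ◅ ε)
      ... | inj₂ u↦U = lift (connected inv (u-vertex , U , u↦U))

  module _ {P : Placement} {r : ℕ} (inv : Invariant P (suc r)) where

    Step : Set
    Step = Σ Placement λ P′ → Invariant P′ r × unassigned-lines P′ < unassigned-lines P

    column-step : ∀ {xp xq y} → Placed P (xp , y) → at (columns P) xq ≡ nothing →
                  E T (xp , y) (xq , y) ≡ true → Step
    column-step {xp} {xq} {y} p-placed@(p-vertex , (Xp , Y) , xp↦Xp , y↦Y) xq-unset pq =
      P′ , Grow.grow inv p-vertex (xp↦Xp , y↦Y) q-unplaced pq (assign-at (columns P) xq-unset X-fresh , y↦Y)
                     (proj₁ X-candidate) (proj₂ X-candidate) preserves only-q-new columns-grow inj₁ ,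
      +-monoˡ-< (unassigned (rows P)) (unassigned-assign (columns P) xq-unset X-fresh)
      where
      room : length (Fc ++ image (columns P)) < rowDegree r (Xp , Y)
      room = ≤-<-trans (≤-trans (length-++-image (columns P) Fc) room-columns)
                       (core-suc⇒rowDegree r (Xp , Y) (in-core inv p-vertex (xp↦Xp , y↦Y)))
      chosen : ∃ λ X → E G (Xp , Y) (X , Y) ∧ core r (X , Y) ≡ true × X ∉ Fc ++ image (columns P)
      chosen = fresh (λ X → E G (Xp , Y) (X , Y) ∧ core r (X , Y)) (Fc ++ image (columns P)) room
      X : Fin N
      X = proj₁ chosen
      X-candidate : E G (Xp , Y) (X , Y) ≡ true × core r (X , Y) ≡ true
      X-candidate = ∧-≡-true (E G (Xp , Y) (X , Y)) (proj₁ (proj₂ chosen))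
      X-fresh : X ∉ Fc ++ image (columns P)
      X-fresh = proj₂ (proj₂ chosen)
      P′ : Placement
      P′ = placement (assign (columns P) xq-unset X-fresh) (rows P)
      q-unplaced : ¬ Placed P (xq , y)
      q-unplaced = column-unset⇒unplaced {P} xq-unset
      preserves : ∀ {u U} → P ⊢ u ↦ U → P′ ⊢ u ↦ U
      preserves (x↦X , y↦Y) = assign-preserves (columns P) xq-unset X-fresh x↦X , y↦Y
      only-q-new : ∀ {u U} → IsVertex T u → P′ ⊢ u ↦ U → (u ≡ (xq , y) × U ≡ (X , Y)) ⊎ P ⊢ u ↦ U
      only-q-new {x , y′} u-vertex (x↦X′ , y′↦Y′) with assign-inv (columns P) xq-unset X-fresh x↦X′
      ... | inj₂ x↦X′ = inj₂ (x↦X′ , y′↦Y′)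
      ... | inj₁ (refl , refl) with new-column-meets-one-row inv p-placed xq-unset pq (_ , y′↦Y′) u-vertex
      ...   | refl = inj₁ (refl , cong (X ,_) (just-injective (trans (sym y′↦Y′) y↦Y)))
      columns-grow : ∀ {x} → Assigned (at (columns P′) x) → Assigned (at (columns P) x) ⊎ x ≡ xq
      columns-grow (_ , x↦) with assign-inv (columns P) xq-unset X-fresh x↦
      ... | inj₁ (x≡xq , _) = inj₂ x≡xq
      ... | inj₂ x↦ = inj₁ (_ , x↦)

    row-step : ∀ {x yp yq} → Placed P (x , yp) → at (rows P) yq ≡ nothing →
               E T (x , yp) (x , yq) ≡ true → Step
    row-step {x} {yp} {yq} p-placed@(p-vertex , (X , Yp) , x↦X , yp↦Yp) yq-unset pq =
      P′ , Grow.grow inv p-vertex (x↦X , yp↦Yp) q-unplaced pq (x↦X , assign-at (rows P) yq-unset Y-fresh)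
                     (proj₁ Y-candidate) (proj₂ Y-candidate) preserves only-q-new inj₁ rows-grow ,
      +-monoʳ-< (unassigned (columns P)) (unassigned-assign (rows P) yq-unset Y-fresh)
      where
      room : length (Fr ++ image (rows P)) < columnDegree r (X , Yp)
      room = ≤-<-trans (≤-trans (length-++-image (rows P) Fr) room-rows)
                       (core-suc⇒columnDegree r (X , Yp) (in-core inv p-vertex (x↦X , yp↦Yp)))
      chosen : ∃ λ Y → E G (X , Yp) (X , Y) ∧ core r (X , Y) ≡ true × Y ∉ Fr ++ image (rows P)
      chosen = fresh (λ Y → E G (X , Yp) (X , Y) ∧ core r (X , Y)) (Fr ++ image (rows P)) room
      Y : Fin N
      Y = proj₁ chosen
      Y-candidate : E G (X , Yp) (X , Y) ≡ true × core r (X , Y) ≡ true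
      Y-candidate = ∧-≡-true (E G (X , Yp) (X , Y)) (proj₁ (proj₂ chosen))
      Y-fresh : Y ∉ Fr ++ image (rows P)
      Y-fresh = proj₂ (proj₂ chosen)
      P′ : Placement
      P′ = placement (columns P) (assign (rows P) yq-unset Y-fresh)
      q-unplaced : ¬ Placed P (x , yq)
      q-unplaced = row-unset⇒unplaced {P} yq-unset
      preserves : ∀ {u U} → P ⊢ u ↦ U → P′ ⊢ u ↦ U
      preserves (x↦X , y↦Y) = x↦X , assign-preserves (rows P) yq-unset Y-fresh y↦Y
      only-q-new : ∀ {u U} → IsVertex T u → P′ ⊢ u ↦ U → (u ≡ (x , yq) × U ≡ (X , Y)) ⊎ P ⊢ u ↦ U
      only-q-new {x′ , y} u-vertex (x′↦X′ , y↦Y′) with assign-inv (rows P) yq-unset Y-fresh y↦Y′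
      ... | inj₂ y↦Y′ = inj₂ (x′↦X′ , y↦Y′)
      ... | inj₁ (refl , refl) with new-row-meets-one-column inv p-placed yq-unset pq (_ , x′↦X′) u-vertex
      ...   | refl = inj₁ (refl , cong (_, Y) (just-injective (trans (sym x′↦X′) x↦X)))
      rows-grow : ∀ {y} → Assigned (at (rows P′) y) → Assigned (at (rows P) y) ⊎ y ≡ yq
      rows-grow (_ , y↦) with assign-inv (rows P) yq-unset Y-fresh y↦
      ... | inj₁ (y≡yq , _) = inj₂ y≡yq
      ... | inj₂ y↦ = inj₁ (_ , y↦)

    v-placed : Placed P v
    v-placed = v-vertex , (a , b) , at-root (columns P) , at-root (rows P)

    advance : ∀ {u} → IsVertex T u → ¬ Placed P u → Step
    advance {u} u-vertex u-unplaced
      with first-exit (placed? P) (walk⇒star T (proj₁ tree v u v-vertex u-vertex)) v-placed u-unplaced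
    ... | (xp , yp) , (xq , yq) , p-placed , q-unplaced , pq , _ , q-vertex with E-line T xp yp xq yq pq
    ...   | inj₂ refl with at (columns P) xq in xq↦
    ...     | nothing = column-step p-placed xq↦ pq
    ...     | just X = ⊥-elim (q-unplaced (q-vertex , (X , _) , xq↦ , proj₂ (proj₂ (proj₂ p-placed))))
    advance {u} u-vertex u-unplaced
        | (xp , yp) , (xq , yq) , p-placed , q-unplaced , pq , _ , q-vertex | inj₁ refl with at (rows P) yq in yq↦
    ...     | nothing = row-step p-placed yq↦ pq
    ...     | just Y = ⊥-elim (q-unplaced (q-vertex , (_ , Y) , proj₁ (proj₂ (proj₂ p-placed)) , yq↦))

  unplaced⇒unassigned : ∀ {P u} → IsVertex T u → ¬ Placed P u → 0 < unassigned-lines P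
  unplaced⇒unassigned {P} {x , y} u-vertex u-unplaced with at (columns P) x in x↦ | at (rows P) y in y↦
  ... | nothing | _ = ≤-trans (∃⇒count>0 (is-nothing ∘ at (columns P)) (cong is-nothing x↦)) (m≤m+n _ _)
  ... | just _ | nothing = ≤-trans (∃⇒count>0 (is-nothing ∘ at (rows P)) (cong is-nothing y↦)) (m≤n+m _ _)
  ... | just X | just Y = ⊥-elim (u-unplaced (u-vertex , (X , Y) , x↦ , y↦))

  AvoidingEmbedding : Set
  AvoidingEmbedding = Σ (Embedding T G) λ φ → φc φ s ≡ a × φr φ t ≡ b
                      × (∀ j → j ≢ s → φc φ j ∉ Fc) × (∀ j → j ≢ t → φr φ j ∉ Fr)

  -- Lines of T that contain no vertex are still unassigned here; any fresh images will do for them.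
  finish : ∀ {P r} → Invariant P r → (∀ u → IsVertex T u → Placed P u) → Δ < N → AvoidingEmbedding
  finish {P} inv all-placed Δ<N
    with φc′ , φc-injective , φc-agrees , φc-avoids ← complete (columns P) (≤-<-trans room-columns Δ<N)
       | φr′ , φr-injective , φr-agrees , φr-avoids ← complete (rows P) (≤-<-trans room-rows Δ<N)
    = φ , φc-agrees (at-root (columns P)) , φr-agrees (at-root (rows P)) , φc-avoids , φr-avoids
    where
    image-of : ∀ u → IsVertex T u → P ⊢ u ↦ (φc′ (proj₁ u) , φr′ (proj₂ u))
    image-of u u-vertex with _ , (X , Y) , x↦X , y↦Y ← all-placed u u-vertex
      rewrite φc-agrees x↦X | φr-agrees y↦Y = x↦X , y↦Y
    φ : Embedding T G
    φ = record
      { φc = φc′ ; φr = φr′ ; φc-inj = φc-injective ; φr-inj = φr-injective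
      ; φ-edge = λ x y x′ y′ e → edges inv (image-of (x , y) (proj₁ (E-vert T _ _ e)))
                                          (image-of (x′ , y′) (proj₂ (E-vert T _ _ e))) e
      }

  embed-from : ∀ r {P} → Invariant P r → unassigned-lines P ≤ r → Δ < N → AvoidingEmbedding
  embed-from r {P} inv ≤r Δ<N
    with any? (λ x → any? λ y → (V T (x , y) ≟ᵇ true) ×-dec ¬? (placed? P (x , y)))
  ... | no none = finish inv all-placed Δ<N
    where
    all-placed : ∀ u → IsVertex T u → Placed P u
    all-placed (x , y) u-vertex =
      decidable-stable (placed? P (x , y)) λ u-unplaced → none (x , y , u-vertex , u-unplaced)
  ... | yes (x , y , u-vertex , u-unplaced) with r | inv | ≤r
  ...   | zero | _ | ≤r = ⊥-elim (<⇒≱ (unplaced⇒unassigned {P} {x , y} u-vertex u-unplaced) ≤r)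
  ...   | suc r′ | inv | ≤r with P′ , inv′ , shrinks ← advance inv u-vertex u-unplaced
    = embed-from r′ inv′ (≤-pred (≤-trans shrinks ≤r)) Δ<N

  P₀ : Placement
  P₀ = placement singleton singleton

  P₀-maps-only-v : ∀ {u U} → P₀ ⊢ u ↦ U → u ≡ v × U ≡ (a , b)
  P₀-maps-only-v {x , y} (x↦ , y↦) with update-nothing-inv s a x x↦ | update-nothing-inv t b y y↦
  ... | refl , refl | refl , refl = refl , refl

  start : core (suc (cT + rT)) (a , b) ≡ true → Invariant P₀ (suc (cT + rT))
  start ab-core = record
    { edges = edges₀ ; in-core = in-core₀ ; column-placed = column-placed₀ ; row-placed = row-placed₀
    ; connected = connected₀
    }
    where
    v-placed₀ : Placed P₀ v
    v-placed₀ = v-vertex , (a , b) , at-root (columns P₀) , at-root (rows P₀)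
    edges₀ : ∀ {u w U W} → P₀ ⊢ u ↦ U → P₀ ⊢ w ↦ W → E T u w ≡ true → E G U W ≡ true
    edges₀ {u} {w} u↦U w↦W uw with P₀-maps-only-v {u} u↦U | P₀-maps-only-v {w} w↦W
    ... | refl , _ | refl , _ = ⊥-elim (E-irreflexive T uw refl)
    in-core₀ : ∀ {u U} → IsVertex T u → P₀ ⊢ u ↦ U → core (suc (cT + rT)) U ≡ true
    in-core₀ {u} _ u↦U with P₀-maps-only-v {u} u↦U
    ... | _ , refl = ab-core
    column-placed₀ : ∀ {x y} → IsVertex T (x , y) → Assigned (at (columns P₀) x) →
                     ∃ λ y′ → Placed P₀ (x , y′)
    column-placed₀ {x} _ (_ , x↦) with update-nothing-inv s a x x↦
    ... | refl , _ = t , v-placed₀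
    row-placed₀ : ∀ {x y} → IsVertex T (x , y) → Assigned (at (rows P₀) y) →
                  ∃ λ x′ → Placed P₀ (x′ , y)
    row-placed₀ {y = y} _ (_ , y↦) with update-nothing-inv t b y y↦
    ... | refl , _ = s , v-placed₀
    connected₀ : ∀ {u} → Placed P₀ u → Star (EdgeWithin T (Placed P₀)) v u
    connected₀ {u} (_ , _ , u↦U) with P₀-maps-only-v {u} u↦U
    ... | refl , _ = ε

  -- There are at most cT + rT steps; the one extra round also guarantees Δ < N.
  embed : core (suc (cT + rT)) (a , b) ≡ true → AvoidingEmbedding
  embed ab-core = embed-from (suc (cT + rT)) (start ab-core) few-lines (core-suc⇒Δ<N (cT + rT) (a , b) ab-core)
    where
    few-lines : unassigned-lines P₀ ≤ suc (cT + rT)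
    few-lines = ≤-trans (+-mono-≤ (count≤n (is-nothing ∘ at (columns P₀))) (count≤n (is-nothing ∘ at (rows P₀))))
                        (n≤1+n _)

-- Disjoint copies

module _ {N : ℕ} where

  used : ∀ {n m} → (Fin n → Fin m → Fin N) → List (Fin N)
  used {zero} fs = []
  used {suc n} fs = tabulate (fs zero) ++ used (fs ∘ suc)

  length-used : ∀ {n m} (fs : Fin n → Fin m → Fin N) → length (used fs) ≡ n * m
  length-used {zero} fs = refl
  length-used {suc n} fs =
    trans (length-++ (tabulate (fs zero))) (cong₂ _+_ (length-tabulate (fs zero)) (length-used (fs ∘ suc)))

  ∈-used : ∀ {n m} (fs : Fin n → Fin m → Fin N) i j → fs i j ∈ used fs
  ∈-used fs zero j = ∈-++⁺ˡ (∈-tabulate⁺ j)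
  ∈-used fs (suc i) j = ∈-++⁺ʳ _ (∈-used (fs ∘ suc) i j)

  meets-only-at-root : ∀ {n m} {j₀ : Fin m} {f : Fin m → Fin N} {fs : Fin n → Fin m → Fin N} →
                       (∀ i → Injective _≡_ _≡_ (fs i)) → (∀ i → fs i j₀ ≡ f j₀) →
                       (∀ j → j ≢ j₀ → f j ∉ used fs) →
                       ∀ i j₁ j₂ → f j₁ ≡ fs i j₂ → j₁ ≡ j₀ × j₂ ≡ j₀
  meets-only-at-root {j₀ = j₀} {fs = fs} fs-inj fs-root f-avoids i j₁ j₂ e with j₁ ≟ j₀
  ... | no j₁≢j₀ = ⊥-elim (f-avoids j₁ j₁≢j₀ (subst (_∈ used fs) (sym e) (∈-used fs i j₂)))
  ... | yes refl = refl , fs-inj i (trans (sym e) (sym (fs-root i)))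

module _ {cT rT N : ℕ} {T : GridSubgraph cT rT} {s : Fin cT} {t : Fin rT} {G : GridSubgraph N N} {a b : Fin N} where

  add-copy : ∀ {n} ((φ , _) : Diverse T (s , t) G n (a , b)) →
             (Σ (Embedding T G) λ ψ → φc ψ s ≡ a × φr ψ t ≡ b
               × (∀ j → j ≢ s → φc ψ j ∉ used (φc ∘ φ)) × (∀ j → j ≢ t → φr ψ j ∉ used (φr ∘ φ))) →
             Diverse T (s , t) G (suc n) (a , b)
  add-copy (φ , roots , columns-disjoint , rows-disjoint) (ψ , ψs , ψt , ψ-columns , ψ-rows) =
    φ′ , roots′ , columns-disjoint′ , rows-disjoint′
    where
    φ′ : Fin (suc _) → Embedding T G
    φ′ zero = ψ
    φ′ (suc i) = φ i
    roots′ : ∀ i → φc (φ′ i) s ≡ a × φr (φ′ i) t ≡ b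
    roots′ zero = ψs , ψt
    roots′ (suc i) = roots i
    new-column : ∀ i j₁ j₂ → φc ψ j₁ ≡ φc (φ i) j₂ → j₁ ≡ s × j₂ ≡ s
    new-column = meets-only-at-root (φc-inj ∘ φ) (λ i → trans (proj₁ (roots i)) (sym ψs)) ψ-columns
    new-row : ∀ i j₁ j₂ → φr ψ j₁ ≡ φr (φ i) j₂ → j₁ ≡ t × j₂ ≡ t
    new-row = meets-only-at-root (φr-inj ∘ φ) (λ i → trans (proj₂ (roots i)) (sym ψt)) ψ-rows
    columns-disjoint′ : ∀ i₁ i₂ → i₁ ≢ i₂ → ∀ j₁ j₂ →
                        φc (φ′ i₁) j₁ ≡ φc (φ′ i₂) j₂ → j₁ ≡ s × j₂ ≡ s
    columns-disjoint′ zero zero i₁≢i₂ = ⊥-elim (i₁≢i₂ refl)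
    columns-disjoint′ zero (suc i) _ j₁ j₂ = new-column i j₁ j₂
    columns-disjoint′ (suc i) zero _ j₁ j₂ = swap ∘ new-column i j₂ j₁ ∘ sym
    columns-disjoint′ (suc i₁) (suc i₂) i₁≢i₂ = columns-disjoint i₁ i₂ (i₁≢i₂ ∘ cong suc)
    rows-disjoint′ : ∀ i₁ i₂ → i₁ ≢ i₂ → ∀ j₁ j₂ →
                     φr (φ′ i₁) j₁ ≡ φr (φ′ i₂) j₂ → j₁ ≡ t × j₂ ≡ t
    rows-disjoint′ zero zero i₁≢i₂ = ⊥-elim (i₁≢i₂ refl)
    rows-disjoint′ zero (suc i) _ j₁ j₂ = new-row i j₁ j₂
    rows-disjoint′ (suc i) zero _ j₁ j₂ = swap ∘ new-row i j₂ j₁ ∘ sym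
    rows-disjoint′ (suc i₁) (suc i₂) i₁≢i₂ = rows-disjoint i₁ i₂ (i₁≢i₂ ∘ cong suc)

module Copies (c : ℕ) {cT rT : ℕ} (T : GridSubgraph cT rT) (simple : IsSimple T) (tree : IsTree T)
              {s : Fin cT} {t : Fin rT} (v-vertex : IsVertex T (s , t)) {N : ℕ} (G : GridSubgraph N N) where

  Δ L : ℕ
  Δ = c * (cT + rT)
  L = suc (cT + rT)

  open Pruning G Δ public

  room : ∀ {n m} (fs : Fin n → Fin m → Fin N) → n < c → m ≤ cT + rT → length (used fs) + m ≤ Δ
  room {n} {m} fs n<c m≤cT+rT = begin
    length (used fs) + m    ≡⟨ cong (_+ m) (length-used fs) ⟩
    n * m + m               ≡⟨ +-comm (n * m) m ⟩
    suc n * m               ≤⟨ *-monoˡ-≤ m n<c ⟩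
    c * m                   ≤⟨ *-monoʳ-≤ c m≤cT+rT ⟩
    c * (cT + rT)           ∎
    where open ≤-Reasoning

  core⇒diverse : ∀ {a b} → core L (a , b) ≡ true → ∀ n → n ≤ c → Diverse T (s , t) G n (a , b)
  core⇒diverse ab-core zero _ = (λ ()) , (λ ()) , (λ ()) , λ ()
  core⇒diverse {a} {b} ab-core (suc n) n<c = add-copy family
      (Embed.embed T simple tree v-vertex G Δ a b (used (φc ∘ φ)) (used (φr ∘ φ))
                   (room (φc ∘ φ) n<c (m≤m+n cT rT)) (room (φr ∘ φ) n<c (m≤n+m rT cT)) ab-core)
    where
    family : Diverse T (s , t) G n (a , b)
    family = core⇒diverse ab-core n (<⇒≤ n<c)
    φ : Fin n → Embedding T G
    φ = proj₁ family

  core-large : ∀ {k} → ¬ HasCoclique G k → N * N ≤ cellCount (core L) + L * (suc Δ + suc Δ) * N * k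
  core-large {k} no-coclique = begin
    N * N
      ≡⟨ cellCount+cellCount-not (core L) ⟨
    cellCount (core L) + cellCount (not ∘ core L)
      ≤⟨ +-monoʳ-≤ _ (core-complement no-coclique L) ⟩
    cellCount (core L) + L * (N * (k * suc Δ) + N * (k * suc Δ))
      ≡⟨ cong (cellCount (core L) +_) (regroup L N k (suc Δ)) ⟩
    cellCount (core L) + L * (suc Δ + suc Δ) * N * k
      ∎
    where
    open ≤-Reasoning
    regroup : ∀ L N k D → L * (N * (k * D) + N * (k * D)) ≡ L * (D + D) * N * k
    regroup = solve-∀

lemma4p2 : (c : ℕ) → 1 ≤ c →
    {cT rT : ℕ} (T : GridSubgraph cT rT) → IsSimpleTree T →
    (v : Cell cT rT) → IsVertex T v →
    Σ ℕ λ c' →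
      (N k : ℕ) → 1 ≤ N → 1 ≤ k →
      (G : GridSubgraph N N) → IsSpanning G → ¬ HasCoclique G k →
      Σ ℕ λ m → (N * N ≤ m + c' * N * k) × AtLeast {N} m (Diverse T v G c)
lemma4p2 c _ {cT} {rT} T (simple , tree) (s , t) v-vertex =
  suc (cT + rT) * (suc (c * (cT + rT)) + suc (c * (cT + rT))) , λ N k _ _ G _ no-coclique →
    let open Copies c T simple tree v-vertex G
        g , g-injective , g-core = enumerate-cells N (core L)
    in cellCount (core L) , core-large no-coclique , g , g-injective , λ i → core⇒diverse (g-core i) c ≤-refl
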